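{- Let $A \in \mathbb{Z}^{m\times n}$ and $b \in \mathbb{Z}^m$, let $\mathcal{P} = \{x \in \mathbb{R}^n_{\geq 0} : Ax = b\}$ and let $\mathcal{P}_I = \operatorname{Conv}(\mathcal{P}\cap\mathbb{Z}^n)$ be its integer hull. If $v$ is a vertex of $\mathcal{P}_I$, then the system \[ Ax = 0;\quad -1 \le x_i \le 1 \ \ \forall i \in \operatorname{supp}(v);\quad x_i = 0\ \ \forall i \notin \operatorname{supp}(v);\quad x \in \mathbb{Z}^n \] has no non-zero solution.
   Context: $\operatorname{supp}(x)=\{i : x_i\neq 0\}$. A point $v\in\mathcal{P}_I$ is a vertex if $v\notin\operatorname{Conv}(\mathcal{P}_I\setminus\{v\})$.
   Formalization: The polyhedron 𝒫, its integer hull 𝒫_I and the vertex v are taken in ℚ^n instead of ℝ^n, with convex combinations formed using rational weights. -}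

module Defs where

open import Data.Nat using (ℕ; zero; suc)
open import Data.Fin using (Fin; zero; suc)
open import Data.Integer as ℤ using (ℤ)
open import Data.Rational as ℚ using (ℚ; 0ℚ; 1ℚ; _/_)
open import Data.Product using (Σ; _×_)
open import Relation.Binary.PropositionalEquality using (_≡_)
open import Relation.Nullary using (¬_)

Mat : ℕ → ℕ → Set
Mat m n = Fin m → Fin n → ℤ

Pt : ℕ → Set
Pt n = Fin n → ℚ

ι : ℤ → ℚ
ι z = z / 1

sumℚ : (k : ℕ) → (Fin k → ℚ) → ℚ
sumℚ zero    f = 0ℚ
sumℚ (suc k) f = f zero ℚ.+ sumℚ k (λ j → f (suc j))

sumℤ : (k : ℕ) → (Fin k → ℤ) → ℤ
sumℤ zero    f = ℤ.+ 0
sumℤ (suc k) f = f zero ℤ.+ sumℤ k (λ j → f (suc j))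

Conv : {n : ℕ} → (Pt n → Set) → Pt n → Set
Conv {n} S x =
  Σ ℕ λ k → Σ (Fin k → Pt n) λ p → Σ (Fin k → ℚ) λ w →
    (∀ j → 0ℚ ℚ.≤ w j) × (sumℚ k w ≡ 1ℚ) × (∀ j → S (p j)) ×
    (∀ i → x i ≡ sumℚ k (λ j → w j ℚ.* p j i))

InP : {m n : ℕ} → Mat m n → (Fin m → ℤ) → Pt n → Set
InP {m} {n} A b x =
  (∀ i → 0ℚ ℚ.≤ x i) × (∀ r → sumℚ n (λ i → ι (A r i) ℚ.* x i) ≡ ι (b r))

Integral : {n : ℕ} → Pt n → Set
Integral {n} x = Σ (Fin n → ℤ) λ z → ∀ i → x i ≡ ι (z i)

IntHull : {m n : ℕ} → Mat m n → (Fin m → ℤ) → Pt n → Set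
IntHull A b = Conv (λ x → InP A b x × Integral x)

IsVertex : {n : ℕ} → (Pt n → Set) → Pt n → Set
IsVertex Q v = Q v × ¬ Conv (λ y → Q y × ¬ (∀ i → y i ≡ v i)) v

-- A vertex of a convex hull Conv S is one of the generators, so v = ι z
-- for an integral point z of P.  Given such an x, the support conditions make
-- z + x and z − x non-negative, and Ax = 0 keeps them in P; both differ from v
-- because x ≠ 0.  Then v = ½ (z + x) + ½ (z − x) expresses v as a convex
-- combination of points of P_I other than v, contradicting that v is a vertex.

module Submission where

open import Defs
open import Data.Nat using (ℕ; zero; suc; s≤s; z≤n)
open import Data.Fin using (Fin; zero; suc)
import Data.Fin.Properties as FinP
open import Data.Integer using (ℤ; _≤_; +_; -_)
import Data.Integer as ℤ
import Data.Integer.Properties as ℤP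
open import Data.Integer.Tactic.RingSolver using (solve-∀)
open import Algebra.Properties.AbelianGroup ℤP.+-0-abelianGroup using (identityʳ-unique)
open import Data.Rational as ℚ using (ℚ; 0ℚ; 1ℚ; mkℚ; ½)
import Data.Rational.Properties as ℚP
import Data.Rational.Unnormalised as ℚᵘ
import Data.Rational.Unnormalised.Properties as ℚᵘP
open import Data.Nat.Coprimality as Coprime using (1-coprimeTo)
open import Data.Product using (Σ; _×_; _,_; proj₁; proj₂)
open import Data.Empty using (⊥-elim)
open import Relation.Binary.PropositionalEquality
open import Relation.Nullary using (¬_; yes; no)

-- The integer z as a rational in normal form (denominator 1); ι z is equal to
-- it, and this form makes the homomorphism laws checkable by computation.
ι′ : ℤ → ℚ
ι′ z = mkℚ z 0 (Coprime.sym (1-coprimeTo _))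

ι≡ι′ : ∀ z → ι z ≡ ι′ z
ι≡ι′ z = ℚP.↥p/↧p≡p (ι′ z)

ι-+ : ∀ a c → ι (a ℤ.+ c) ≡ ι a ℚ.+ ι c
ι-+ a c rewrite ι≡ι′ (a ℤ.+ c) | ι≡ι′ a | ι≡ι′ c =
  ℚP.toℚᵘ-injective (ℚᵘP.≃-trans (ℚᵘ.*≡* (cross a c)) (ℚᵘP.≃-sym (ℚP.toℚᵘ-homo-+ (ι′ a) (ι′ c))))
  where
  cross : ∀ p q → (p ℤ.+ q) ℤ.* + 1 ≡ (p ℤ.* + 1 ℤ.+ q ℤ.* + 1) ℤ.* + 1
  cross = solve-∀

ι-* : ∀ a c → ι (a ℤ.* c) ≡ ι a ℚ.* ι c
ι-* a c rewrite ι≡ι′ (a ℤ.* c) | ι≡ι′ a | ι≡ι′ c =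
  ℚP.toℚᵘ-injective (ℚᵘP.≃-trans (ℚᵘ.*≡* refl) (ℚᵘP.≃-sym (ℚP.toℚᵘ-homo-* (ι′ a) (ι′ c))))

ι-0 : ι (+ 0) ≡ 0ℚ
ι-0 = ι≡ι′ (+ 0)

ι-injective : ∀ {a c} → ι a ≡ ι c → a ≡ c
ι-injective {a} {c} e = cong ℚ.↥_ (trans (sym (ι≡ι′ a)) (trans e (ι≡ι′ c)))

ι-nonneg : ∀ a → + 0 ≤ a → 0ℚ ℚ.≤ ι a
ι-nonneg a h rewrite ι≡ι′ a = ℚ.*≤* (subst (+ 0 ≤_) (sym (ℤP.*-identityʳ a)) h)

ι-nonneg⁻¹ : ∀ a → 0ℚ ℚ.≤ ι a → + 0 ≤ a
ι-nonneg⁻¹ a h rewrite ι≡ι′ a = subst (+ 0 ≤_) (ℤP.*-identityʳ a) (ℚP.drop-*≤* h)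

sumℚ-cong : ∀ k {f g : Fin k → ℚ} → (∀ i → f i ≡ g i) → sumℚ k f ≡ sumℚ k g
sumℚ-cong zero    e = refl
sumℚ-cong (suc k) e = cong₂ ℚ._+_ (e zero) (sumℚ-cong k (λ i → e (suc i)))

ι-sum : ∀ k (f : Fin k → ℤ) → sumℚ k (λ i → ι (f i)) ≡ ι (sumℤ k f)
ι-sum zero    f = sym ι-0
ι-sum (suc k) f = begin
  ι (f zero) ℚ.+ sumℚ k (λ i → ι (f (suc i)))
    ≡⟨ cong (ι (f zero) ℚ.+_) (ι-sum k (λ i → f (suc i))) ⟩
  ι (f zero) ℚ.+ ι (sumℤ k (λ i → f (suc i)))  ≡⟨ sym (ι-+ (f zero) _) ⟩
  ι (sumℤ (suc k) f)                            ∎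
  where open ≡-Reasoning

_·_ : {n : ℕ} → (Fin n → ℤ) → (Fin n → ℤ) → ℤ
_·_ {n} a y = sumℤ n (λ i → a i ℤ.* y i)

sumℤ-cong : ∀ k {f g : Fin k → ℤ} → (∀ i → f i ≡ g i) → sumℤ k f ≡ sumℤ k g
sumℤ-cong zero    e = refl
sumℤ-cong (suc k) e = cong₂ ℤ._+_ (e zero) (sumℤ-cong k (λ i → e (suc i)))

sumℤ-+ : ∀ k (f g : Fin k → ℤ) → sumℤ k (λ i → f i ℤ.+ g i) ≡ sumℤ k f ℤ.+ sumℤ k g
sumℤ-+ zero    f g = refl
sumℤ-+ (suc k) f g =
  trans (cong (λ t → (f zero ℤ.+ g zero) ℤ.+ t) (sumℤ-+ k _ _)) (interchange (f zero) (g zero) _ _)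
  where
  interchange : ∀ p q r s → (p ℤ.+ q) ℤ.+ (r ℤ.+ s) ≡ (p ℤ.+ r) ℤ.+ (q ℤ.+ s)
  interchange = solve-∀

sumℤ-neg : ∀ k (f : Fin k → ℤ) → sumℤ k (λ i → - f i) ≡ - sumℤ k f
sumℤ-neg zero    f = refl
sumℤ-neg (suc k) f =
  trans (cong (λ t → - f zero ℤ.+ t) (sumℤ-neg k _)) (sym (ℤP.neg-distrib-+ (f zero) _))

·-neg : ∀ {n} (a x : Fin n → ℤ) → a · (λ i → - x i) ≡ - (a · x)
·-neg {n} a x =
  trans (sumℤ-cong n (λ i → sym (ℤP.neg-distribʳ-* (a i) (x i)))) (sumℤ-neg n _)

·-translate : ∀ {n} (a y x : Fin n → ℤ) {c} → a · y ≡ c → a · x ≡ + 0 →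
              a · (λ i → y i ℤ.+ x i) ≡ c
·-translate {n} a y x {c} ay≡c ax≡0 = begin
  a · (λ i → y i ℤ.+ x i)  ≡⟨ sumℤ-cong n (λ i → ℤP.*-distribˡ-+ (a i) (y i) (x i)) ⟩
  sumℤ n (λ i → a i ℤ.* y i ℤ.+ a i ℤ.* x i)  ≡⟨ sumℤ-+ n _ _ ⟩
  a · y ℤ.+ a · x  ≡⟨ cong₂ ℤ._+_ ay≡c ax≡0 ⟩
  c ℤ.+ + 0        ≡⟨ ℤP.+-identityʳ c ⟩
  c                ∎
  where open ≡-Reasoning

ι-· : ∀ {n} (a y : Fin n → ℤ) → sumℚ n (λ i → ι (a i) ℚ.* ι (y i)) ≡ ι (a · y)
ι-· {n} a y = trans (sumℚ-cong n (λ i → sym (ι-* (a i) (y i)))) (ι-sum n _)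

generator-in-Conv : ∀ {n} (S : Pt n → Set) (y : Pt n) → S y → Conv S y
generator-in-Conv S y y∈S =
  1 , (λ _ → y) , (λ _ → 1ℚ) , (λ _ → ℚ.*≤* (ℤ.+≤+ z≤n)) , refl , (λ _ → y∈S) ,
  (λ i → sym (trans (ℚP.+-identityʳ _) (ℚP.*-identityˡ _)))

midpoint-in-Conv : ∀ {n} (S : Pt n → Set) (y y′ v : Pt n) → S y → S y′ →
                   (∀ i → v i ≡ ½ ℚ.* (y i ℚ.+ y′ i)) → Conv S v
midpoint-in-Conv S y y′ v y∈S y′∈S v≡mid =
  2 , ends , (λ _ → ½) , (λ _ → ℚ.*≤* (ℤ.+≤+ z≤n)) , refl , ends∈S , combination
  where
  ends : Fin 2 → _
  ends zero    = y
  ends (suc _) = y′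
  ends∈S : ∀ j → S (ends j)
  ends∈S zero       = y∈S
  ends∈S (suc zero) = y′∈S
  combination : ∀ i → v i ≡ ½ ℚ.* y i ℚ.+ (½ ℚ.* y′ i ℚ.+ 0ℚ)
  combination i = trans (v≡mid i)
    (trans (ℚP.*-distribˡ-+ ½ (y i) (y′ i)) (cong (½ ℚ.* y i ℚ.+_) (sym (ℚP.+-identityʳ _))))

-- A vertex of Conv S is (pointwise equal to) a generator: if every generator
-- in a combination representing v differed from v, they would all be points of
-- Conv S other than v, and v would not be a vertex.
vertex-is-generator : ∀ {n} (S : Pt n → Set) (v : Pt n) → IsVertex (Conv S) v →
                      Σ (Pt n) λ y → S y × (∀ i → y i ≡ v i)
vertex-is-generator S v ((k , p , w , w≥0 , w-sum , p∈S , v≡comb) , not-combination)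
  with FinP.any? (λ j → FinP.all? (λ i → p j i ℚP.≟ v i))
... | yes (j , pⱼ≡v) = p j , p∈S j , pⱼ≡v
... | no  none       = ⊥-elim (not-combination
        (k , p , w , w≥0 , w-sum ,
         (λ j → generator-in-Conv S (p j) (p∈S j) , λ pⱼ≡v → none (j , pⱼ≡v)) , v≡comb))

IntegralPoint : {m n : ℕ} → Mat m n → (Fin m → ℤ) → Pt n → Set
IntegralPoint A b y = InP A b y × Integral y

solution-in-P : ∀ {m n} (A : Mat m n) (b : Fin m → ℤ) (z : Fin n → ℤ) →
                (∀ i → + 0 ≤ z i) → (∀ r → A r · z ≡ b r) →
                IntegralPoint A b (λ i → ι (z i))
solution-in-P A b z z≥0 Az≡b =
  ((λ i → ι-nonneg (z i) (z≥0 i)) , (λ r → trans (ι-· (A r) z) (cong ι (Az≡b r)))) ,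
  (z , λ i → refl)

solution-of-P : ∀ {m n} (A : Mat m n) (b : Fin m → ℤ) (y : Pt n) (z : Fin n → ℤ) →
                InP A b y → (∀ i → y i ≡ ι (z i)) →
                (∀ i → + 0 ≤ z i) × (∀ r → A r · z ≡ b r)
solution-of-P {n = n} A b y z (y≥0 , Ay≡b) y≡z =
  (λ i → ι-nonneg⁻¹ (z i) (subst (0ℚ ℚ.≤_) (y≡z i) (y≥0 i))) ,
  (λ r → ι-injective (trans (sym (ι-· (A r) z))
           (trans (sumℚ-cong n (λ i → cong (ι (A r i) ℚ.*_) (sym (y≡z i)))) (Ay≡b r))))

nonneg-step : ∀ z d → + 0 ≤ z → (z ≡ + 0 → d ≡ + 0) → (¬ z ≡ + 0 → - (+ 1) ≤ d) →
              + 0 ≤ z ℤ.+ d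
nonneg-step (+ zero)  d _ d≡0 _  rewrite d≡0 refl = ℤ.+≤+ z≤n
nonneg-step (+ suc k) d _ _ d≥-1 = ℤP.+-mono-≤ (ℤ.+≤+ (s≤s z≤n)) (d≥-1 λ ())

midpoint-of-step : ∀ z x → ½ ℚ.* (ι (z ℤ.+ x) ℚ.+ ι (z ℤ.+ - x)) ≡ ι z
midpoint-of-step z x = begin
  ½ ℚ.* (ι (z ℤ.+ x) ℚ.+ ι (z ℤ.+ - x))  ≡⟨ cong (½ ℚ.*_) (sym (ι-+ (z ℤ.+ x) _)) ⟩
  ½ ℚ.* ι ((z ℤ.+ x) ℤ.+ (z ℤ.+ - x))    ≡⟨ cong (λ t → ½ ℚ.* ι t) (twice z x) ⟩
  ½ ℚ.* ι (z ℤ.+ z)                      ≡⟨ cong (½ ℚ.*_) (ι-+ z z) ⟩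
  ½ ℚ.* (ι z ℚ.+ ι z)                    ≡⟨ ℚP.*-distribˡ-+ ½ (ι z) (ι z) ⟩
  ½ ℚ.* ι z ℚ.+ ½ ℚ.* ι z                ≡⟨ sym (ℚP.*-distribʳ-+ (ι z) ½ ½) ⟩
  1ℚ ℚ.* ι z                             ≡⟨ ℚP.*-identityˡ (ι z) ⟩
  ι z                                    ∎
  where
  open ≡-Reasoning
  twice : ∀ p q → (p ℤ.+ q) ℤ.+ (p ℤ.+ - q) ≡ p ℤ.+ p
  twice = solve-∀

kernel-step-in-P : ∀ {m n} (A : Mat m n) (b : Fin m → ℤ) (z d : Fin n → ℤ) →
                   (∀ i → + 0 ≤ z i) → (∀ r → A r · z ≡ b r) → (∀ r → A r · d ≡ + 0) →
                   (∀ i → z i ≡ + 0 → d i ≡ + 0) → (∀ i → ¬ z i ≡ + 0 → - (+ 1) ≤ d i) →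
                   IntegralPoint A b (λ i → ι (z i ℤ.+ d i))
kernel-step-in-P A b z d z≥0 Az≡b Ad≡0 d-off d-on =
  solution-in-P A b (λ i → z i ℤ.+ d i)
    (λ i → nonneg-step (z i) (d i) (z≥0 i) (d-off i) (d-on i))
    (λ r → ·-translate (A r) z d (Az≡b r) (Ad≡0 r))

lemma2 : {m n : ℕ} (A : Mat m n) (b : Fin m → ℤ) (v : Pt n) →
    IsVertex (IntHull A b) v →
    ¬ (Σ (Fin n → ℤ) λ x →
         (∀ r → sumℤ n (λ i → A r i Data.Integer.* x i) ≡ + 0) ×
         (∀ i → ¬ (v i ≡ 0ℚ) → (- (+ 1) ≤ x i) × (x i ≤ + 1)) ×
         (∀ i → v i ≡ 0ℚ → x i ≡ + 0) ×
         ¬ (∀ i → x i ≡ + 0))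
lemma2 A b v vertex@(_ , not-combination) (x , Ax≡0 , x-on , x-off , x≢0)
  with vertex-is-generator (IntegralPoint A b) v vertex
... | y , (y∈P , z , y≡z) , y≡v with solution-of-P A b y z y∈P y≡z
...   | z≥0 , Az≡b =
  not-combination (midpoint-in-Conv OtherPoint _ _ v z+x z−x v-is-midpoint)
  where
  OtherPoint : Pt _ → Set
  OtherPoint w = IntHull A b w × ¬ (∀ i → w i ≡ v i)

  v≡z : ∀ i → v i ≡ ι (z i)
  v≡z i = trans (sym (y≡v i)) (y≡z i)

  z≡0⇒v≡0 : ∀ i → z i ≡ + 0 → v i ≡ 0ℚ
  z≡0⇒v≡0 i e = trans (v≡z i) (trans (cong ι e) ι-0)
  v≡0⇒z≡0 : ∀ i → v i ≡ 0ℚ → z i ≡ + 0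
  v≡0⇒z≡0 i e = ι-injective (trans (sym (v≡z i)) (trans e (sym ι-0)))

  other-point : (d : Fin _ → ℤ) → (∀ r → A r · d ≡ + 0) →
                (∀ i → v i ≡ 0ℚ → d i ≡ + 0) → (∀ i → ¬ v i ≡ 0ℚ → - (+ 1) ≤ d i) →
                ¬ (∀ i → d i ≡ + 0) → OtherPoint (λ i → ι (z i ℤ.+ d i))
  other-point d Ad≡0 d-off d-on d≢0 = z+d∈P_I , z+d≢v
    where
    z+d∈P_I : IntHull A b (λ i → ι (z i ℤ.+ d i))
    z+d∈P_I = generator-in-Conv (IntegralPoint A b) _
      (kernel-step-in-P A b z d z≥0 Az≡b Ad≡0
        (λ i e → d-off i (z≡0⇒v≡0 i e)) (λ i z≢0 → d-on i (λ e → z≢0 (v≡0⇒z≡0 i e))))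
    z+d≢v : ¬ (∀ i → ι (z i ℤ.+ d i) ≡ v i)
    z+d≢v z+d≡v =
      d≢0 (λ i → identityʳ-unique (z i) (d i) (ι-injective (trans (z+d≡v i) (v≡z i))))

  z+x : OtherPoint (λ i → ι (z i ℤ.+ x i))
  z+x = other-point x Ax≡0 x-off (λ i ne → proj₁ (x-on i ne)) x≢0

  z−x : OtherPoint (λ i → ι (z i ℤ.+ - x i))
  z−x = other-point (λ i → - x i) (λ r → trans (·-neg (A r) x) (cong -_ (Ax≡0 r)))
    (λ i e → cong -_ (x-off i e)) (λ i ne → ℤP.neg-mono-≤ (proj₂ (x-on i ne)))
    (λ −x≡0 → x≢0 (λ i → ℤP.neg-injective (−x≡0 i)))

  v-is-midpoint : ∀ i → v i ≡ ½ ℚ.* (ι (z i ℤ.+ x i) ℚ.+ ι (z i ℤ.+ - x i))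
  v-is-midpoint i = trans (v≡z i) (sym (midpoint-of-step (z i) (x i)))
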